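{- Let $b\ge 3$ be odd and let $O(b)$ be the set of odd integers $q$ with $1\le q\le b-1$ and $\gcd(q,b)=1$. The map $f(q)=|b-2q|$ is a permutation of $O(b)$. Let $(q_0,q_1,\dots,q_{p-1})$ be one of its cycles, listed in the order $q_j=f(q_{j-1})$, where $p=\mathrm{pes}(b)$ is the length of the cycle, and extend it periodically by $q_{t}=q_{t \bmod p}$. Put $S=q_0+q_1+\dots+q_{p-1}$. Consider the regular $(2b)$-gon with vertices labelled $0,1,\dots,2b-1$ counterclockwise. Start at the vertex labelled $0$ and at the $t$-th step ($t=0,1,2,\dots$) move counterclockwise by $q_t$ positions, i.e. along the diagonal joining the current vertex to the vertex $q_t$ positions further on. The resulting sequence of vertex labels is $v_0=0$, $v_n=\left(\sum_{t=0}^{n-1} q_t\right)\bmod 2b$ for $n\ge1$. Then: 1. The sequence $(v_n)_{n\ge 0}$ is purely periodic, so the trail is a closed, counterclockwise oriented Euler tour. 2. The primitive period of $(v_n)_{n\ge0}$ is $$L=\frac{2b\,\mathrm{pes}(b)}{\gcd(S,\,2b)}.$$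
   Context: The cycles of $f$ on $O(b)$ are the (unsigned) Schick cycles. In the paper they are obtained as follows. The first input is $q_0=1$. Each further input is the smallest element of $O(b)$ not yet contained in a previously generated cycle. All cycles have the same length, denoted $\mathrm{pes}(b)$. -}

module Defs where

open import Data.Nat using (ℕ; zero; suc; _+_; _*_; _≤_; _<_; ∣_-_∣; _/_; _%_)
open import Data.Nat.GCD using (gcd)
open import Data.Product using (_×_; ∃-syntax)
open import Relation.Binary.PropositionalEquality using (_≡_)

Odd : ℕ → Set
Odd q = q % 2 ≡ 1

InO : ℕ → ℕ → Set
InO b q = Odd q × 1 ≤ q × suc q ≤ b × gcd q b ≡ 1

f : ℕ → ℕ → ℕ
f b q = ∣ b - 2 * q ∣

iter : (ℕ → ℕ) → ℕ → ℕ → ℕ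
iter g zero    x = x
iter g (suc n) x = g (iter g n x)

IsCycleLength : (ℕ → ℕ) → ℕ → ℕ → Set
IsCycleLength g x p =
  0 < p × iter g p x ≡ x × (∀ k → 0 < k → iter g k x ≡ x → p ≤ k)

sumTo : (ℕ → ℕ) → ℕ → ℕ
sumTo a zero    = 0
sumTo a (suc n) = sumTo a n + a n

IsPeriod : (ℕ → ℕ) → ℕ → Set
IsPeriod v L = 0 < L × (∀ n → v (n + L) ≡ v n)

PurelyPeriodic : (ℕ → ℕ) → Set
PurelyPeriodic v = ∃[ L ] IsPeriod v L

IsPrimitivePeriod : (ℕ → ℕ) → ℕ → Set
IsPrimitivePeriod v L = IsPeriod v L × (∀ L′ → IsPeriod v L′ → L ≤ L′)

-- natural-number division, only used with a positive divisor
divℕ : ℕ → ℕ → ℕ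
divℕ m zero    = 0
divℕ m (suc k) = m / suc k

-- natural-number remainder, only used with a positive modulus
modℕ : ℕ → ℕ → ℕ
modℕ m zero    = m
modℕ m (suc k) = m % suc k

-- the Schick cycle sequence q_t = f^t(q₀) (equals q_{t mod p} by periodicity)
qseq : ℕ → ℕ → ℕ → ℕ
qseq b q₀ t = iter (f b) t q₀

vseq : ℕ → ℕ → ℕ → ℕ
vseq b q₀ n = modℕ (sumTo (qseq b q₀) n) (2 * b)

-- The map f(q) = |b − 2q| keeps O(b) invariant: |b − 2q| is odd and below b, and a common
-- divisor of it and b divides 2q, hence q, because b is odd. It is injective because two
-- preimages on opposite sides of b/2 would give b = q + r, a sum of two odd numbers.
-- Along a Schick cycle of length p the partial sums grow by S = q₀ + ⋯ + q_{p−1} per turn, so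
-- (v_n) has period c·p with c = 2b / gcd(S, 2b), the additive order of S modulo 2b.
-- Conversely, as every step q_t is below 2b, a period L of (v_n) recovers q_L = q₀ from
-- v_{L+1} − v_L; hence p ∣ L, and writing L = kp, v_L = 0 forces 2b ∣ kS, that is c ∣ k.
module Submission where

open import Defs
open import Data.Nat
open import Data.Nat.Properties
open import Data.Nat.DivMod
open import Data.Nat.Divisibility
open import Data.Nat.GCD
open import Data.Nat.Coprimality using (Coprime; coprime-factors)
open import Data.Nat.Tactic.RingSolver using (solve-∀)
open import Data.Product using (_×_; _,_; proj₁; proj₂)
open import Data.Sum using (_⊎_; inj₁; inj₂)
open import Relation.Nullary using (contradiction)
open import Relation.Binary.PropositionalEquality
import Algebra.Properties.CommutativeSemigroup +-commutativeSemigroup as +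
import Algebra.Properties.CommutativeSemigroup *-commutativeSemigroup as *

private
  variable
    b d m n p q r x : ℕ

n%2≡0⊎Odd : ∀ n → n % 2 ≡ 0 ⊎ Odd n
n%2≡0⊎Odd n with n % 2 | m%n<n n 2
... | 0 | _ = inj₁ refl
... | 1 | _ = inj₂ refl
... | suc (suc _) | s≤s (s≤s ())

[2m]%2≡0 : ∀ m → (2 * m) % 2 ≡ 0
[2m]%2≡0 m = trans (cong (_% 2) (*-comm 2 m)) (m*n%n≡0 m 2)

[2m+n]%2≡n%2 : ∀ m n → (2 * m + n) % 2 ≡ n % 2
[2m+n]%2≡n%2 m n = begin
  (2 * m + n) % 2 ≡⟨ cong (_% 2) (trans (+-comm (2 * m) n) (cong (n +_) (*-comm 2 m))) ⟩
  (n + m * 2) % 2 ≡⟨ [m+kn]%n≡m%n n m 2 ⟩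
  n % 2           ∎
  where open ≡-Reasoning

odd+odd≡even : ∀ m n → Odd m → Odd n → (m + n) % 2 ≡ 0
odd+odd≡even m n om on = trans (%-distribˡ-+ m n 2) (cong₂ (λ i j → (i + j) % 2) om on)

odd+even≡odd : ∀ m n → Odd m → n % 2 ≡ 0 → Odd (m + n)
odd+even≡odd m n om en = trans (%-distribˡ-+ m n 2) (cong₂ (λ i j → (i + j) % 2) om en)

odd⇒coprime-2 : Odd b → Coprime 2 b
odd⇒coprime-2 ob {0} (0∣2 , _) = contradiction (0∣⇒≡0 0∣2) λ ()
odd⇒coprime-2 ob {1} _ = refl
odd⇒coprime-2 {b} ob {2} (_ , 2∣b) = contradiction (trans (sym (n∣m⇒m%n≡0 b 2 2∣b)) ob) λ ()
odd⇒coprime-2 ob {suc (suc (suc _))} (i∣2 , _) = contradiction (∣⇒≤ i∣2) λ { (s≤s (s≤s ())) }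

∣m-n∣-cases : ∀ m n → m ≡ n + ∣ m - n ∣ ⊎ n ≡ m + ∣ m - n ∣
∣m-n∣-cases m n with ≤-total n m
... | inj₁ n≤m = inj₁ (trans (sym (m+[n∸m]≡n n≤m)) (cong (n +_) (sym (m≤n⇒∣n-m∣≡n∸m n≤m))))
... | inj₂ m≤n = inj₂ (trans (sym (m+[n∸m]≡n m≤n)) (cong (m +_) (sym (m≤n⇒∣m-n∣≡n∸m m≤n))))

∣m∣∣m-n∣⇒∣n : d ∣ m → d ∣ ∣ m - n ∣ → d ∣ n
∣m∣∣m-n∣⇒∣n {d} {m} {n} d∣m d∣x with ∣m-n∣-cases m n
... | inj₁ e = ∣m+n∣m⇒∣n (subst (d ∣_) (trans e (+-comm n _)) d∣m) d∣x
... | inj₂ e = subst (d ∣_) (sym e) (∣m∣n⇒∣m+n d∣m d∣x)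

f-odd : Odd b → Odd (f b q)
f-odd {b} {q} ob with ∣m-n∣-cases b (2 * q)
... | inj₁ e = trans (sym ([2m+n]%2≡n%2 q (f b q))) (subst Odd e ob)
... | inj₂ e with n%2≡0⊎Odd (f b q)
...   | inj₂ odd = odd
...   | inj₁ even = contradiction (trans (sym ([2m]%2≡0 q)) 2q-odd) λ ()
  where
  2q-odd : Odd (2 * q)
  2q-odd = subst Odd (sym e) (odd+even≡odd b (f b q) ob even)

odd⇒>0 : Odd n → 0 < n
odd⇒>0 {suc n} _ = z<s

f<b : 0 < q → q < b → f b q < b
f<b {q} {b} q>0 q<b with ∣m-n∣-cases b (2 * q)
... | inj₁ e = subst (f b q <_) (sym e) (m<n+m (f b q) (*-monoʳ-< 2 q>0))
... | inj₂ e = +-cancelˡ-< b (f b q) b (subst (_< b + b) e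
                 (subst (2 * q <_) (cong (b +_) (+-identityʳ b)) (*-monoʳ-< 2 q<b)))

gcd-f : Odd b → gcd q b ≡ 1 → gcd (f b q) b ≡ 1
gcd-f {b} {q} ob gcd≡1 = ∣1⇒≡1 (subst (g ∣_) gcd≡1 (gcd-greatest g∣q g∣b))
  where
  g = gcd (f b q) b
  g∣b : g ∣ b
  g∣b = gcd[m,n]∣n (f b q) b
  g∣q : g ∣ q
  g∣q = coprime-factors (odd⇒coprime-2 {b} ob)
          (∣m∣∣m-n∣⇒∣n g∣b (gcd[m,n]∣m (f b q) b) , ∣-trans g∣b (m∣m*n q))

f-InO : Odd b → InO b q → InO b (f b q)
f-InO {b} {q} ob (_ , q>0 , q<b , gcd≡1) =
  fq-odd , odd⇒>0 fq-odd , f<b q>0 q<b , gcd-f {b} {q} ob gcd≡1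
  where
  fq-odd : Odd (f b q)
  fq-odd = f-odd {b} {q} ob

b-2q≡2r-b⇒b≡q+r : b ≡ 2 * q + x → 2 * r ≡ b + x → b ≡ q + r
b-2q≡2r-b⇒b≡q+r {b} {q} {x} {r} e₁ e₂ = begin
  b           ≡⟨ e₁ ⟩
  2 * q + x   ≡⟨ 2m+n≡m+[m+n] q x ⟩
  q + (q + x) ≡⟨ cong (q +_) (sym r≡q+x) ⟩
  q + r       ∎
  where
  open ≡-Reasoning
  2m+n≡m+[m+n] : ∀ m n → 2 * m + n ≡ m + (m + n)
  2m+n≡m+[m+n] = solve-∀
  2m+n+n≡2[m+n] : ∀ m n → 2 * m + n + n ≡ 2 * (m + n)
  2m+n+n≡2[m+n] = solve-∀
  r≡q+x : r ≡ q + x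
  r≡q+x = *-cancelˡ-≡ r (q + x) 2 (begin
    2 * r         ≡⟨ e₂ ⟩
    b + x         ≡⟨ cong (_+ x) e₁ ⟩
    2 * q + x + x ≡⟨ 2m+n+n≡2[m+n] q x ⟩
    2 * (q + x)   ∎)

odd≢odd+odd : ∀ q r → Odd b → Odd q → Odd r → b ≢ q + r
odd≢odd+odd q r ob oq or b≡q+r =
  contradiction (trans (sym (subst Odd b≡q+r ob)) (odd+odd≡even q r oq or)) λ ()

f-injective : Odd b → Odd q → Odd r → f b q ≡ f b r → q ≡ r
f-injective {b} {q} {r} ob oq or fq≡fr with ∣m-n∣-cases b (2 * q) | ∣m-n∣-cases b (2 * r)
... | inj₁ e₁ | inj₁ e₂ = *-cancelˡ-≡ q r 2 (+-cancelʳ-≡ (f b q) (2 * q) (2 * r)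
                            (trans (sym e₁) (trans e₂ (cong (2 * r +_) (sym fq≡fr)))))
... | inj₂ e₁ | inj₂ e₂ = *-cancelˡ-≡ q r 2 (trans e₁ (trans (cong (b +_) fq≡fr) (sym e₂)))
... | inj₁ e₁ | inj₂ e₂ = contradiction (b-2q≡2r-b⇒b≡q+r {q = q} {r = r} e₁ (trans e₂ (cong (b +_) (sym fq≡fr))))
                            (odd≢odd+odd q r ob oq or)
... | inj₂ e₁ | inj₁ e₂ = contradiction (b-2q≡2r-b⇒b≡q+r {q = r} {r = q} e₂ (trans e₁ (cong (b +_) fq≡fr)))
                            (odd≢odd+odd r q ob or oq)

iter-preserves : ∀ (P : ℕ → Set) {g : ℕ → ℕ} → (∀ {y} → P y → P (g y)) → P x → ∀ t → P (iter g t x)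
iter-preserves P step Px zero = Px
iter-preserves P step Px (suc t) = step (iter-preserves P step Px t)

iter-+ : ∀ (g : ℕ → ℕ) m n x → iter g (m + n) x ≡ iter g m (iter g n x)
iter-+ g zero n x = refl
iter-+ g (suc m) n x = cong g (iter-+ g m n x)

orbit : (ℕ → ℕ) → ℕ → ℕ → ℕ
orbit g x t = iter g t x

periodic-+* : ∀ (a : ℕ → ℕ) → (∀ n → a (n + p) ≡ a n) → ∀ n k → a (n + k * p) ≡ a n
periodic-+* a per n zero = cong a (+-identityʳ n)
periodic-+* {p} a per n (suc k) = begin
  a (n + (p + k * p)) ≡⟨ cong a (+.x∙yz≈xz∙y n p (k * p)) ⟩
  a (n + k * p + p)   ≡⟨ per (n + k * p) ⟩
  a (n + k * p)       ≡⟨ periodic-+* a per n k ⟩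
  a n                 ∎
  where open ≡-Reasoning

sumTo-+period : ∀ (a : ℕ → ℕ) → (∀ n → a (n + p) ≡ a n) →
                ∀ m → sumTo a (m + p) ≡ sumTo a m + sumTo a p
sumTo-+period a per zero = refl
sumTo-+period {p} a per (suc m) = begin
  sumTo a (m + p) + a (m + p)    ≡⟨ cong₂ _+_ (sumTo-+period a per m) (per m) ⟩
  sumTo a m + sumTo a p + a m    ≡⟨ +.xy∙z≈xz∙y (sumTo a m) (sumTo a p) (a m) ⟩
  sumTo a m + a m + sumTo a p    ∎
  where open ≡-Reasoning

sumTo-+* : ∀ (a : ℕ → ℕ) → (∀ n → a (n + p) ≡ a n) →
           ∀ n k → sumTo a (n + k * p) ≡ sumTo a n + k * sumTo a p
sumTo-+* a per n zero = trans (cong (sumTo a) (+-identityʳ n)) (sym (+-identityʳ _))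
sumTo-+* {p} a per n (suc k) = begin
  sumTo a (n + (p + k * p)) ≡⟨ cong (sumTo a) (+.x∙yz≈xz∙y n p (k * p)) ⟩
  sumTo a (n + k * p + p)   ≡⟨ sumTo-+period a per (n + k * p) ⟩
  sumTo a (n + k * p) + S   ≡⟨ cong (_+ S) (sumTo-+* a per n k) ⟩
  sumTo a n + k * S + S     ≡⟨ +.xy∙z≈x∙zy (sumTo a n) (k * S) S ⟩
  sumTo a n + (S + k * S)   ∎
  where
  open ≡-Reasoning
  S = sumTo a p

module _ {g : ℕ → ℕ} {x p : ℕ} (cycle : IsCycleLength g x p) where

  cycle⇒periodic : ∀ n → orbit g x (n + p) ≡ orbit g x n
  cycle⇒periodic n = trans (iter-+ g n p x) (cong (iter g n) (proj₁ (proj₂ cycle)))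

  no-return-before-cycleLength : r < p → orbit g x r ≡ x → r ≡ 0
  no-return-before-cycleLength {zero} _ _ = refl
  no-return-before-cycleLength {suc r} r<p back =
    contradiction (proj₂ (proj₂ cycle) (suc r) z<s back) (<⇒≱ r<p)

  return⇒cycleLength∣ : orbit g x m ≡ x → p ∣ m
  return⇒cycleLength∣ {m} back = m%n≡0⇒n∣m m p
    (no-return-before-cycleLength (m%n<n m p) (begin
      orbit g x (m % p)                 ≡⟨ periodic-+* (orbit g x) cycle⇒periodic (m % p) (m / p) ⟨
      orbit g x (m % p + (m / p) * p)   ≡⟨ cong (orbit g x) (m≡m%n+[m/n]*n m p) ⟨
      orbit g x m                       ≡⟨ back ⟩
      x                                 ∎))
    where
    open ≡-Reasoning
    instance
      p≢0 : NonZero p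
      p≢0 = >-nonZero (proj₁ cycle)

[m+n]%d≡m%d : ∀ m {n d} .{{_ : NonZero d}} → d ∣ n → (m + n) % d ≡ m % d
[m+n]%d≡m%d m {d = d} (divides-refl k) = [m+kn]%n≡m%n m k d

m∣[m/gcd[n,m]]*n : ∀ m n .{{_ : NonZero (gcd n m)}} → m ∣ (m / gcd n m) * n
m∣[m/gcd[n,m]]*n m n = subst (_∣ (m / gcd n m) * n) (m/n*n≡m (gcd[m,n]∣n n m))
  (*-monoʳ-∣ (m / gcd n m) (gcd[m,n]∣m n m))

m∣k*n⇒m/gcd[n,m]∣k : ∀ {m n k} .{{_ : NonZero (gcd n m)}} → m ∣ k * n → m / gcd n m ∣ k
m∣k*n⇒m/gcd[n,m]∣k {m} {n} {k} m∣kn = *-cancelʳ-∣ (gcd n m) (begin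
  m / gcd n m * gcd n m   ≡⟨ m/n*n≡m (gcd[m,n]∣n n m) ⟩
  m                       ∣⟨ gcd-greatest m∣kn (n∣m*n k) ⟩
  gcd (k * n) (k * m)     ≡⟨ c*gcd[m,n]≡gcd[cm,cn] k n m ⟨
  k * gcd n m             ∎)
  where open ∣-Reasoning

divℕ≡/ : ∀ m n .{{_ : NonZero n}} → divℕ m n ≡ m / n
divℕ≡/ m (suc n) = refl

module OrbitPartialSums {g : ℕ → ℕ} {x p N : ℕ} {{_ : NonZero N}}
                        (cycle : IsCycleLength g x p) (bounded : ∀ t → orbit g x t < N) where

  a : ℕ → ℕ
  a = orbit g x

  S : ℕ
  S = sumTo a p

  v : ℕ → ℕ
  v n = sumTo a n % N

  G : ℕ
  G = gcd S N

  instance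
    G≢0 : NonZero G
    G≢0 = ≢-nonZero (gcd[m,n]≢0 S N (inj₂ (≢-nonZero⁻¹ N)))

  c : ℕ
  c = N / G

  sumTo-multiple : ∀ n k → sumTo a (n + k * p) ≡ sumTo a n + k * S
  sumTo-multiple = sumTo-+* a (cycle⇒periodic cycle)

  period : IsPeriod v (c * p)
  period = c*p>0 , λ n →
    trans (cong (_% N) (sumTo-multiple n c)) ([m+n]%d≡m%d (sumTo a n) (m∣[m/gcd[n,m]]*n N S))
    where
    c*p>0 : 0 < c * p
    c*p>0 = >-nonZero⁻¹ (c * p)
      {{m*n≢0 c p {{≢-nonZero (n/gcd[m,n]≢0 S N)}} {{>-nonZero (proj₁ cycle)}}}}

  period⇒return : ∀ {L} → IsPeriod v L → a L ≡ x × N ∣ sumTo a L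
  period⇒return {L} (_ , shift) = back , N∣sum
    where
    open ≡-Reasoning
    N∣sum : N ∣ sumTo a L
    N∣sum = m%n≡0⇒n∣m (sumTo a L) N (trans (shift 0) (m<n⇒m%n≡m (>-nonZero⁻¹ N)))
    back : a L ≡ x
    back = begin
      a L                        ≡⟨ m<n⇒m%n≡m (bounded L) ⟨
      a L % N                    ≡⟨ [m+n]%d≡m%d (a L) N∣sum ⟨
      (a L + sumTo a L) % N      ≡⟨ cong (_% N) (+-comm (a L) (sumTo a L)) ⟩
      v (1 + L)                  ≡⟨ shift 1 ⟩
      x % N                      ≡⟨ m<n⇒m%n≡m (bounded 0) ⟩
      x                          ∎

  c*p≤period : ∀ {L} → IsPeriod v L → c * p ≤ L
  c*p≤period {L} per with period⇒return per
  ... | back , N∣sum with return⇒cycleLength∣ cycle {L} back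
  ... | divides-refl k = *-monoˡ-≤ p (∣⇒≤ {{m*n≢0⇒m≢0 k {{>-nonZero (proj₁ per)}}}}
                           (m∣k*n⇒m/gcd[n,m]∣k (subst (N ∣_) (sumTo-multiple 0 k) N∣sum)))

  primitivePeriod : IsPrimitivePeriod v (divℕ (N * p) G)
  primitivePeriod = subst (IsPrimitivePeriod v) (sym divℕ[N*p]G≡c*p) (period , λ _ → c*p≤period)
    where
    open ≡-Reasoning
    divℕ[N*p]G≡c*p : divℕ (N * p) G ≡ c * p
    divℕ[N*p]G≡c*p = begin
      divℕ (N * p) G     ≡⟨ divℕ≡/ (N * p) G ⟩
      N * p / G          ≡⟨ cong (λ n → n * p / G) (m/n*n≡m (gcd[m,n]∣n S N)) ⟨
      c * G * p / G      ≡⟨ cong (_/ G) (*.xy∙z≈xz∙y c G p) ⟩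
      c * p * G / G      ≡⟨ m*n/n≡m (c * p) G ⟩
      c * p              ∎

theorem4 : ∀ (b : ℕ) → Odd b → 3 ≤ b →
    ((∀ q → InO b q → InO b (f b q)) ×
     (∀ q r → InO b q → InO b r → f b q ≡ f b r → q ≡ r)) ×
    (∀ (q₀ p : ℕ) → InO b q₀ → IsCycleLength (f b) q₀ p →
      PurelyPeriodic (vseq b q₀) ×
      IsPrimitivePeriod (vseq b q₀)
        (divℕ (2 * b * p) (gcd (sumTo (qseq b q₀) p) (2 * b))))
-- vseq and divℕ compute only once the modulus 2 * b is visibly a successor.
theorem4 zero _ ()
theorem4 b@(suc _) ob _ =
  ((λ q → f-InO {b} {q} ob) , (λ q r (oq , _) (or , _) → f-injective {b} {q} {r} ob oq or)) ,
  vertexPeriods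
  where
  vertexPeriods : ∀ (q₀ p : ℕ) → InO b q₀ → IsCycleLength (f b) q₀ p →
    PurelyPeriodic (vseq b q₀) ×
    IsPrimitivePeriod (vseq b q₀) (divℕ (2 * b * p) (gcd (sumTo (qseq b q₀) p) (2 * b)))
  vertexPeriods q₀ p q₀∈O cycle = (c * p , period) , primitivePeriod
    where
    orbit<2b : ∀ t → orbit (f b) q₀ t < 2 * b
    orbit<2b t = ≤-trans (proj₁ (proj₂ (proj₂ (iter-preserves (InO b) (f-InO ob) q₀∈O t)))) (m≤n*m b 2)
    open OrbitPartialSums cycle orbit<2b
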